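{- For every integer $n\geq 4$, $pd(K_n\odot W_{n+1})\leq n$.
   Context: For a connected graph $G$ and an ordered partition $\Pi=\{S_1,\dots,S_k\}$ of $V(G)$, $r(v\mid\Pi)=(d(v,S_1),\dots,d(v,S_k))$ where $d(v,S)=\min_{x\in S}d(v,x)$ with $d$ the shortest-path distance; $\Pi$ is resolving if $r(u\mid\Pi)\neq r(v\mid\Pi)$ for all distinct $u,v$; $pd(G)$ is the minimum size of a resolving partition. $K_n$ is the complete graph; the wheel $W_m$ ($m\geq3$) is the cycle $C_m$ plus a center vertex adjacent to all cycle vertices. The corona product $G\odot H$, $|V(G)|=n$, is obtained from $G$ and $n$ disjoint copies $H_1,\dots,H_n$ of $H$ by joining the $i$-th vertex of $G$ to every vertex of $H_i$. -}

module Defs where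

open import Data.Nat using (ℕ; zero; suc; _+_; _<_; _≤_; NonZero)
open import Data.Nat.DivMod using (_%_)
open import Data.Fin using (Fin; toℕ)
open import Data.Maybe using (Maybe; just; nothing)
open import Data.Sum using (_⊎_; inj₁; inj₂)
open import Data.Product using (_×_; _,_; ∃; ∃-syntax; Σ)
open import Data.Empty using (⊥)
open import Data.Unit using (⊤)
open import Function using (Surjective)
open import Relation.Binary.PropositionalEquality using (_≡_; _≢_)
open import Relation.Nullary using (¬_)

record Graph : Set₁ where
  field
    V   : Set
    Adj : V → V → Set
open Graph public

K : ℕ → Graph
K n = record { V = Fin n ; Adj = λ i j → i ≢ j }

CycAdj : (m : ℕ) → .{{_ : NonZero m}} → Fin m → Fin m → Set
CycAdj m i j = (suc (toℕ i) % m ≡ toℕ j) ⊎ (suc (toℕ j) % m ≡ toℕ i)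

-- Wheel W_m: cycle C_m (vertices just i) plus a center (nothing) adjacent to every cycle vertex
W : (m : ℕ) → .{{_ : NonZero m}} → Graph
W m = record { V = Maybe (Fin m) ; Adj = adj }
  where
  adj : Maybe (Fin m) → Maybe (Fin m) → Set
  adj nothing  nothing  = ⊥
  adj nothing  (just _) = ⊤
  adj (just _) nothing  = ⊤
  adj (just i) (just j) = CycAdj m i j

-- Corona product G ⊙ H: vertices of G (inj₁ a) and, for each a, a copy of H (inj₂ (a , h));
-- a is joined to every vertex of the a-th copy of H.
_⊙_ : Graph → Graph → Graph
G ⊙ H = record { V = V G ⊎ (V G × V H) ; Adj = adj }
  where
  adj : V G ⊎ (V G × V H) → V G ⊎ (V G × V H) → Set
  adj (inj₁ a)       (inj₁ b)       = Adj G a b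
  adj (inj₁ a)       (inj₂ (b , _)) = a ≡ b
  adj (inj₂ (a , _)) (inj₁ b)       = a ≡ b
  adj (inj₂ (a , h)) (inj₂ (b , k)) = (a ≡ b) × Adj H h k

Reach : (G : Graph) → ℕ → V G → V G → Set
Reach G zero    u v = u ≡ v
Reach G (suc k) u v = Reach G k u v ⊎ (∃[ w ] (Adj G u w × Reach G k w v))

Dist : (G : Graph) → V G → V G → ℕ → Set
Dist G u v d = Reach G d u v × (∀ d' → d' < d → ¬ Reach G d' u v)

record OrderedPartition (G : Graph) (k : ℕ) : Set where
  field
    cls      : V G → Fin k
    nonempty : Surjective _≡_ _≡_ cls
open OrderedPartition public

DistToClass : (G : Graph) {k : ℕ} → OrderedPartition G k → V G → Fin k → ℕ → Set
DistToClass G Π v i d =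
  (∃[ x ] (cls Π x ≡ i × Reach G d v x)) ×
  (∀ x → cls Π x ≡ i → ∀ d' → d' < d → ¬ Reach G d' v x)

Resolving : (G : Graph) {k : ℕ} → OrderedPartition G k → Set
Resolving G Π = ∀ u v → u ≢ v →
  ∃[ i ] ∃[ du ] ∃[ dv ] (DistToClass G Π u i du × DistToClass G Π v i dv × du ≢ dv)

pd≤ : Graph → ℕ → Set
pd≤ G m = ∃[ k ] (k ≤ m × Σ (OrderedPartition G k) (Resolving G))

-- Put every hub of K_n in class 0 and colour the a-th copy of W_{n+1} by punchIn a ∘ label, where
-- label merges the centre of the wheel with the cycle vertices 0 and 1, merges 2 with 3, and is
-- injective otherwise; so copy a meets exactly the classes other than a. A class a ≠ 0 misses the
-- hubs and copy a, hence lies at distance 2 from hub a and 3 from copy a, while it lies at distance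
-- 1 from every other hub, at most 2 from every hub (through copy 0) and at most 2 from the other
-- copies. This separates any two vertices not in a common copy. Two vertices of one copy with the
-- same class are separated by the label class {2, 3} or {4}, adjacent to exactly one of them.
module Submission where

open import Defs
open import Data.Nat using (ℕ; zero; suc; _≤_; _<_; _+_; _⊓_; _%_; z≤n; s≤s)
open import Data.Nat.Properties
open import Data.Fin as Fin using (Fin; zero; suc; toℕ; #_; punchIn; punchOut)
open import Data.Fin.Properties using (punchIn-injective; punchInᵢ≢i; punchIn-punchOut)
open import Data.Maybe using (Maybe; just; nothing)
import Data.Maybe.Properties as Maybe
open import Data.List using (List; _∷_; map; filter; cartesianProduct; _++_; allFin)
open import Data.List.Membership.Propositional using (_∈_)
open import Data.List.Membership.Propositional.Properties
  using (∈-map⁺; ∈-++⁺ˡ; ∈-++⁺ʳ; ∈-cartesianProduct⁺; ∈-allFin; ∈-filter⁺)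
open import Data.List.Relation.Unary.Any using (here; there)
open import Data.List.Relation.Unary.All using (lookup)
open import Data.List.Relation.Unary.All.Properties using (all-filter)
import Data.List.Extrema ≤-totalOrder as Extrema
open import Data.Sum using (_⊎_; inj₁; inj₂)
open import Data.Product using (_×_; _,_; proj₁; proj₂; ∃-syntax)
open import Data.Empty using (⊥-elim)
open import Data.Unit using (tt)
open import Function using (_∘_; id)
open import Relation.Nullary using (Dec; yes; no; ¬_; ¬?)
open import Relation.Nullary.Decidable using (_⊎-dec_)
open import Relation.Binary.Definitions using (DecidableEquality)
open import Relation.Binary.PropositionalEquality

private
  variable
    d e : ℕ

module _ {G : Graph} where

  reach-snoc : ∀ {u w v} → Reach G d u w → Adj G w v → Reach G (suc d) u v
  reach-snoc {zero}  refl               a = inj₂ (_ , a , refl)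
  reach-snoc {suc d} (inj₁ r)           a = inj₁ (reach-snoc r a)
  reach-snoc {suc d} (inj₂ (x , b , r)) a = inj₂ (x , b , reach-snoc r a)

  reach-⊓ : ∀ {u v} → Reach G d u v → Reach G e u v → Reach G (d ⊓ e) u v
  reach-⊓ {d} {e} {u} {v} r s with ⊓-sel d e
  ... | inj₁ eq = subst (λ x → Reach G x u v) (sym eq) r
  ... | inj₂ eq = subst (λ x → Reach G x u v) (sym eq) s

reach-map : ∀ {G H} (f : V G → V H) → (∀ {u v} → Adj G u v → Adj H (f u) (f v)) →
            ∀ {u v} → Reach G d u v → Reach H d (f u) (f v)
reach-map {zero}  f hom refl               = refl
reach-map {suc d} f hom (inj₁ r)           = inj₁ (reach-map f hom r)
reach-map {suc d} f hom (inj₂ (w , a , r)) = inj₂ (f w , hom a , reach-map f hom r)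

record IsDistance (G : Graph) (δ : V G → V G → ℕ) : Set where
  field
    reach   : ∀ u v → Reach G (δ u v) u v
    minimal : ∀ {u v} → Reach G d u v → δ u v ≤ d

  δ-refl : ∀ u → δ u u ≡ 0
  δ-refl u = n≤0⇒n≡0 (minimal refl)

  δ≡0⇒≡ : ∀ {u v} → δ u v ≡ 0 → u ≡ v
  δ≡0⇒≡ {u} {v} eq = subst (λ x → Reach G x u v) eq (reach u v)

  ≢⇒δ>0 : ∀ {u v} → u ≢ v → 0 < δ u v
  ≢⇒δ>0 u≢v = n≢0⇒n>0 (u≢v ∘ δ≡0⇒≡)

  adj⇒δ≤1 : ∀ {u v} → Adj G u v → δ u v ≤ 1
  adj⇒δ≤1 {v = v} a = minimal (inj₂ (v , a , refl))

  δ-lipschitz : ∀ {u w} v → Adj G u w → δ u v ≤ suc (δ w v)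
  δ-lipschitz {w = w} v a = minimal (inj₂ (w , a , reach w v))

lipschitz⇒isDistance : ∀ {G} {δ : V G → V G → ℕ} →
  (∀ u v → Reach G (δ u v) u v) → (∀ u → δ u u ≡ 0) →
  (∀ {u w} v → Adj G u w → δ u v ≤ suc (δ w v)) → IsDistance G δ
lipschitz⇒isDistance {G} {δ} reach refl⇒0 lipschitz = record { reach = reach ; minimal = minimal }
  where
  minimal : ∀ {u v} → Reach G d u v → δ u v ≤ d
  minimal {zero}  {u} refl               = ≤-reflexive (refl⇒0 u)
  minimal {suc d}     (inj₁ r)           = m≤n⇒m≤1+n (minimal r)
  minimal {suc d} {v = v} (inj₂ (w , a , r)) = ≤-trans (lipschitz v a) (s≤s (minimal r))

module DiameterTwo (G : Graph) (_≟_ : DecidableEquality (V G)) (adj? : ∀ u v → Dec (Adj G u v))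
  (common-neighbour : ∀ {u v} → u ≢ v → ¬ Adj G u v → ∃[ w ] (Adj G u w × Adj G w v)) where

  δ : V G → V G → ℕ
  δ u v with u ≟ v | adj? u v
  ... | yes _ | _     = 0
  ... | no _  | yes _ = 1
  ... | no _  | no _  = 2

  non-adjacent⇒δ≡2 : ∀ {u v} → u ≢ v → ¬ Adj G u v → δ u v ≡ 2
  non-adjacent⇒δ≡2 {u} {v} u≢v ¬a with u ≟ v | adj? u v
  ... | yes u≡v | _     = ⊥-elim (u≢v u≡v)
  ... | no _    | yes a = ⊥-elim (¬a a)
  ... | no _    | no _  = refl

  private
    reach : ∀ u v → Reach G (δ u v) u v
    reach u v with u ≟ v | adj? u v
    ... | yes u≡v | _     = u≡v
    ... | no _    | yes a = inj₂ (v , a , refl)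
    ... | no u≢v  | no ¬a with common-neighbour u≢v ¬a
    ...   | w , a , b = inj₂ (w , a , inj₂ (v , b , refl))

    δ-refl : ∀ u → δ u u ≡ 0
    δ-refl u with u ≟ u
    ... | yes _   = refl
    ... | no u≢u  = ⊥-elim (u≢u refl)

    δ≤2 : ∀ u v → δ u v ≤ 2
    δ≤2 u v with u ≟ v | adj? u v
    ... | yes _ | _     = z≤n
    ... | no _  | yes _ = s≤s z≤n
    ... | no _  | no _  = ≤-refl

    adj⇒δ≤1 : ∀ {u v} → Adj G u v → δ u v ≤ 1
    adj⇒δ≤1 {u} {v} a with u ≟ v | adj? u v
    ... | yes _ | _     = z≤n
    ... | no _  | yes _ = ≤-refl
    ... | no _  | no ¬a = ⊥-elim (¬a a)

    ≢⇒δ>0 : ∀ {u v} → u ≢ v → 0 < δ u v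
    ≢⇒δ>0 {u} {v} u≢v with u ≟ v | adj? u v
    ... | yes u≡v | _     = ⊥-elim (u≢v u≡v)
    ... | no _    | yes _ = s≤s z≤n
    ... | no _    | no _  = s≤s z≤n

    lipschitz : ∀ {u w} v → Adj G u w → δ u v ≤ suc (δ w v)
    lipschitz {u} {w} v a = by-cases (w ≟ v)
      where
      by-cases : Dec (w ≡ v) → δ u v ≤ suc (δ w v)
      by-cases (yes refl) = ≤-trans (adj⇒δ≤1 a) (s≤s z≤n)
      by-cases (no w≢v)   = ≤-trans (δ≤2 u v) (s≤s (≢⇒δ>0 w≢v))

  isDistance : IsDistance G δ
  isDistance = lipschitz⇒isDistance reach δ-refl lipschitz

module Corona {G H : Graph} (_≟_ : DecidableEquality (V G))
  {δG δH} (distG : IsDistance G δG) (distH : IsDistance H δH) where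

  private
    module DG = IsDistance distG
    module DH = IsDistance distH

  δ : V (G ⊙ H) → V (G ⊙ H) → ℕ
  δ (inj₁ a)       (inj₁ b)       = δG a b
  δ (inj₁ a)       (inj₂ (b , _)) = suc (δG a b)
  δ (inj₂ (a , _)) (inj₁ b)       = suc (δG a b)
  -- Within a copy of H, the walk through the hub of that copy has length 2.
  δ (inj₂ (a , h)) (inj₂ (b , k)) with a ≟ b
  ... | yes _ = δH h k ⊓ 2
  ... | no _  = 2 + δG a b

  δ-hub-own : ∀ a h → δ (inj₁ a) (inj₂ (a , h)) ≡ 1
  δ-hub-own a h = cong suc (DG.δ-refl a)

  δ-hub-other : ∀ {a b} h → a ≢ b → 2 ≤ δ (inj₁ a) (inj₂ (b , h))
  δ-hub-other h a≢b = s≤s (DG.≢⇒δ>0 a≢b)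

  δ-copy-own : ∀ a h k → δ (inj₂ (a , h)) (inj₂ (a , k)) ≡ δH h k ⊓ 2
  δ-copy-own a h k with a ≟ a
  ... | yes _   = refl
  ... | no a≢a  = ⊥-elim (a≢a refl)

  δ-copy-other : ∀ {a b} h k → a ≢ b → 3 ≤ δ (inj₂ (a , h)) (inj₂ (b , k))
  δ-copy-other {a} {b} h k a≢b with a ≟ b
  ... | yes a≡b = ⊥-elim (a≢b a≡b)
  ... | no _    = s≤s (s≤s (DG.≢⇒δ>0 a≢b))

  private
    hub-walk : ∀ a b → Reach (G ⊙ H) (δG a b) (inj₁ a) (inj₁ b)
    hub-walk a b = reach-map inj₁ id (DG.reach a b)

    reach : ∀ u v → Reach (G ⊙ H) (δ u v) u v
    reach (inj₁ a)       (inj₁ b)       = hub-walk a b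
    reach (inj₁ a)       (inj₂ (b , k)) = reach-snoc (hub-walk a b) refl
    reach (inj₂ (a , h)) (inj₁ b)       = inj₂ (inj₁ a , refl , hub-walk a b)
    reach (inj₂ (a , h)) (inj₂ (b , k)) with a ≟ b
    ... | yes refl = reach-⊓ (reach-map (λ h → inj₂ (a , h)) (λ x → refl , x) (DH.reach h k))
                             (inj₂ (inj₁ a , refl , inj₂ (inj₂ (a , k) , refl , refl)))
    ... | no _     = inj₂ (inj₁ a , refl , reach-snoc (hub-walk a b) refl)

    δ-refl : ∀ u → δ u u ≡ 0
    δ-refl (inj₁ a)       = DG.δ-refl a
    δ-refl (inj₂ (a , h)) = trans (δ-copy-own a h h) (cong (_⊓ 2) (DH.δ-refl h))

    ⊓2-lipschitz : ∀ {x y} → x ≤ suc y → x ⊓ 2 ≤ suc (y ⊓ 2)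
    ⊓2-lipschitz {x} {y} x≤1+y with ⊓-sel y 2
    ... | inj₁ eq = ≤-trans (m⊓n≤m x 2) (subst (λ z → x ≤ suc z) (sym eq) x≤1+y)
    ... | inj₂ eq = ≤-trans (m⊓n≤n x 2) (subst (λ z → 2 ≤ suc z) (sym eq) (n≤1+n 2))

    lipschitz : ∀ {u w} v → Adj (G ⊙ H) u w → δ u v ≤ suc (δ w v)
    lipschitz {inj₁ a} {inj₁ b} (inj₁ c)       a~b = DG.δ-lipschitz c a~b
    lipschitz {inj₁ a} {inj₁ b} (inj₂ (c , k)) a~b = s≤s (DG.δ-lipschitz c a~b)
    lipschitz {inj₁ a} {inj₂ (a , h)} (inj₁ c) refl = ≤-trans (n≤1+n _) (n≤1+n _)
    lipschitz {inj₁ a} {inj₂ (a , h)} (inj₂ (c , k)) refl with a ≟ c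
    ... | yes refl = subst (_≤ suc (δH h k ⊓ 2)) (sym (δ-hub-own a k)) (s≤s z≤n)
    ... | no _     = s≤s (≤-trans (n≤1+n _) (n≤1+n _))
    lipschitz {inj₂ (a , h)} {inj₁ a} (inj₁ c) refl = ≤-refl
    lipschitz {inj₂ (a , h)} {inj₁ a} (inj₂ (c , k)) refl with a ≟ c
    ... | yes refl = ≤-trans (m⊓n≤n _ 2) (s≤s (s≤s z≤n))
    ... | no _     = ≤-refl
    lipschitz {inj₂ (a , h)} {inj₂ (a , h')} (inj₁ c) (refl , _) = n≤1+n _
    lipschitz {inj₂ (a , h)} {inj₂ (a , h')} (inj₂ (c , k)) (refl , h~h') with a ≟ c
    ... | yes _ = ⊓2-lipschitz (DH.δ-lipschitz k h~h')
    ... | no _  = n≤1+n _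

  isDistance : IsDistance (G ⊙ H) δ
  isDistance = lipschitz⇒isDistance reach δ-refl (λ {u} {w} → lipschitz {u} {w})

∈-corona-vertices : ∀ {G H} {xs : List (V G)} {ys : List (V H)} →
  (∀ a → a ∈ xs) → (∀ h → h ∈ ys) →
  ∀ v → v ∈ map inj₁ xs ++ map inj₂ (cartesianProduct xs ys)
∈-corona-vertices ∈xs ∈ys (inj₁ a)       = ∈-++⁺ˡ (∈-map⁺ inj₁ (∈xs a))
∈-corona-vertices ∈xs ∈ys (inj₂ (a , h)) =
  ∈-++⁺ʳ _ (∈-map⁺ inj₂ (∈-cartesianProduct⁺ (∈xs a) (∈ys h)))

module ClassDistance {G : Graph} {δ} (dist : IsDistance G δ)
  {xs : List (V G)} (∈xs : ∀ x → x ∈ xs) {k} (Π : OrderedPartition G k) where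

  open IsDistance dist

  distToClass-exists : ∀ v i → ∃[ d ] DistToClass G Π v i d
  distToClass-exists v i = δ v nearest , (nearest , nearest∈i , reach v nearest) , beyond
    where
    in-class? : ∀ x → Dec (cls Π x ≡ i)
    in-class? x = cls Π x Fin.≟ i

    members : List (V G)
    members = filter in-class? xs

    seed : V G
    seed = proj₁ (nonempty Π i)

    nearest : V G
    nearest = Extrema.argmin (δ v) seed members

    nearest∈i : cls Π nearest ≡ i
    nearest∈i = Extrema.argmin-all (δ v) (proj₂ (nonempty Π i) refl) (all-filter in-class? xs)

    beyond : ∀ x → cls Π x ≡ i → ∀ d' → d' < δ v nearest → ¬ Reach G d' v x
    beyond x x∈i d' d'<δ r = <⇒≱ d'<δ (≤-trans nearest≤x (minimal r))
      where
      nearest≤x : δ v nearest ≤ δ v x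
      nearest≤x = lookup (Extrema.f[argmin]≤f[xs] seed members) (∈-filter⁺ _ (∈xs x) x∈i)

  distToClass≤δ : ∀ {v i d x} → DistToClass G Π v i d → cls Π x ≡ i → d ≤ δ v x
  distToClass≤δ {v} {x = x} (_ , beyond) x∈i = ≮⇒≥ λ δ<d → beyond x x∈i (δ v x) δ<d (reach v x)

  <-distToClass : ∀ {v i d} → DistToClass G Π v i d → (∀ y → cls Π y ≡ i → e < δ v y) → e < d
  <-distToClass ((y , y∈i , r) , _) far = <-≤-trans (far y y∈i) (minimal r)

  Separates : V G → V G → Fin k → Set
  Separates u v i = ∃[ e ] ((∃[ x ] (cls Π x ≡ i × δ u x ≤ e)) × (∀ y → cls Π y ≡ i → e < δ v y))

  Distinguished : V G → V G → Set
  Distinguished u v = ∃[ i ] (Separates u v i ⊎ Separates v u i)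

  separates⇒< : ∀ {u v i du dv} → Separates u v i →
                DistToClass G Π u i du → DistToClass G Π v i dv → du < dv
  separates⇒< (e , (x , x∈i , ux≤e) , far) Du Dv =
    ≤-<-trans (≤-trans (distToClass≤δ Du x∈i) ux≤e) (<-distToClass Dv far)

  separates-own-class : ∀ {u v} → cls Π u ≢ cls Π v → Separates u v (cls Π u)
  separates-own-class {u} {v} cu≢cv =
    0 , (u , refl , ≤-reflexive (δ-refl u)) , λ y y∈u → ≢⇒δ>0 λ { refl → cu≢cv (sym y∈u) }

  resolving : (∀ {u v} → u ≢ v → Distinguished u v) → Resolving G Π
  resolving distinguished u v u≢v with distinguished u≢v
  ... | i , sep with distToClass-exists u i | distToClass-exists v i
  ...   | du , Du | dv , Dv = i , du , dv , Du , Dv , distinct sep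
    where
    distinct : Separates u v i ⊎ Separates v u i → du ≢ dv
    distinct (inj₁ s) = <⇒≢ (separates⇒< s Du Dv)
    distinct (inj₂ s) = ≢-sym (<⇒≢ (separates⇒< s Dv Du))

punchIn≡zero⇒≡zero : ∀ {n} (a : Fin (suc (suc n))) j → punchIn a j ≡ zero → j ≡ zero
punchIn≡zero⇒≡zero (suc a) zero _ = refl

-- The split on k is needed because 5 % (5 + k) only reduces once k is known.
C[5+k]-1≁4 : ∀ k → ¬ CycAdj (5 + k) (# 1) (# 4)
C[5+k]-1≁4 zero    = λ { (inj₁ ()) ; (inj₂ ()) }
C[5+k]-1≁4 (suc k) = λ { (inj₁ ()) ; (inj₂ ()) }

C[5+k]-2≁4 : ∀ k → ¬ CycAdj (5 + k) (# 2) (# 4)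
C[5+k]-2≁4 zero    = λ { (inj₁ ()) ; (inj₂ ()) }
C[5+k]-2≁4 (suc k) = λ { (inj₁ ()) ; (inj₂ ()) }

module Construction (k : ℕ) where

  module Complete = DiameterTwo (K (4 + k)) Fin._≟_ (λ i j → ¬? (i Fin.≟ j))
                                (λ i≢j ¬i≢j → ⊥-elim (¬i≢j i≢j))

  Complete-δ≤1 : ∀ a b → Complete.δ a b ≤ 1
  Complete-δ≤1 a b with a Fin.≟ b
  ... | yes _ = z≤n
  ... | no _  = ≤-refl

  Wheel-adj? : ∀ h h' → Dec (Adj (W (5 + k)) h h')
  Wheel-adj? nothing  nothing  = no λ ()
  Wheel-adj? nothing  (just _) = yes tt
  Wheel-adj? (just _) nothing  = yes tt
  Wheel-adj? (just i) (just j) =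
    (suc (toℕ i) % (5 + k) ≟ toℕ j) ⊎-dec (suc (toℕ j) % (5 + k) ≟ toℕ i)

  through-centre : ∀ {h h'} → h ≢ h' → ¬ Adj (W (5 + k)) h h' →
                   ∃[ w ] (Adj (W (5 + k)) h w × Adj (W (5 + k)) w h')
  through-centre {nothing} {nothing} h≢h' _  = ⊥-elim (h≢h' refl)
  through-centre {nothing} {just _}  _    ¬a = ⊥-elim (¬a tt)
  through-centre {just _}  {nothing} _    ¬a = ⊥-elim (¬a tt)
  through-centre {just _}  {just _}  _    _  = nothing , tt , tt

  module Wheel = DiameterTwo (W (5 + k)) (Maybe.≡-dec Fin._≟_) Wheel-adj? through-centre

  ∈-wheel : ∀ h → h ∈ nothing ∷ map just (allFin (5 + k))
  ∈-wheel nothing  = here refl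
  ∈-wheel (just t) = there (∈-map⁺ just (∈-allFin t))

  label : Maybe (Fin (5 + k)) → Fin (3 + k)
  label nothing                                = zero
  label (just zero)                            = zero
  label (just (suc zero))                      = zero
  label (just (suc (suc zero)))                = suc zero
  label (just (suc (suc (suc zero))))          = suc zero
  label (just (suc (suc (suc (suc t)))))       = suc (suc t)

  representative : Fin (3 + k) → Maybe (Fin (5 + k))
  representative zero          = nothing
  representative (suc zero)    = just (# 2)
  representative (suc (suc t)) = just (suc (suc (suc (suc t))))

  label-representative : ∀ j → label (representative j) ≡ j
  label-representative zero          = refl
  label-representative (suc zero)    = refl
  label-representative (suc (suc t)) = refl

  label≡0 : ∀ h → label h ≡ # 0 → h ≡ nothing ⊎ h ≡ just (# 0) ⊎ h ≡ just (# 1)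
  label≡0 nothing                          _  = inj₁ refl
  label≡0 (just zero)                      _  = inj₂ (inj₁ refl)
  label≡0 (just (suc zero))                _  = inj₂ (inj₂ refl)
  label≡0 (just (suc (suc zero)))          ()
  label≡0 (just (suc (suc (suc zero))))    ()
  label≡0 (just (suc (suc (suc (suc t))))) ()

  label≡1 : ∀ h → label h ≡ # 1 → h ≡ just (# 2) ⊎ h ≡ just (# 3)
  label≡1 (just (suc (suc zero)))          _  = inj₁ refl
  label≡1 (just (suc (suc (suc zero))))    _  = inj₂ refl
  label≡1 nothing                          ()
  label≡1 (just zero)                      ()
  label≡1 (just (suc zero))                ()
  label≡1 (just (suc (suc (suc (suc t))))) ()

  label≡2+ : ∀ h {t} → label h ≡ suc (suc t) → h ≡ just (suc (suc (suc (suc t))))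
  label≡2+ (just (suc (suc (suc (suc t))))) refl = refl
  label≡2+ nothing                          ()
  label≡2+ (just zero)                      ()
  label≡2+ (just (suc zero))                ()
  label≡2+ (just (suc (suc zero)))          ()
  label≡2+ (just (suc (suc (suc zero))))    ()

  label-collision : ∀ {h h'} → label h ≡ label h' → h ≢ h' → label h ≡ # 0 ⊎ label h ≡ # 1
  label-collision {h} {h'} eq h≢h' with label h in lh
  ... | zero          = inj₁ refl
  ... | suc zero      = inj₂ refl
  ... | suc (suc t)   = ⊥-elim (h≢h' (trans (label≡2+ h lh) (sym (label≡2+ h' (sym eq)))))

  Near : Fin (3 + k) → Maybe (Fin (5 + k)) → Set
  Near j h = ∃[ h' ] (label h' ≡ j × Adj (W (5 + k)) h h')

  Far : Fin (3 + k) → Maybe (Fin (5 + k)) → Set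
  Far j h = ∀ h' → label h' ≡ j → h ≢ h' × ¬ Adj (W (5 + k)) h h'

  Splits : Fin (3 + k) → Maybe (Fin (5 + k)) → Maybe (Fin (5 + k)) → Set
  Splits j h h' = Near j h × Far j h'

  near-1-centre : Near (# 1) nothing
  near-1-centre = just (# 2) , refl , tt

  near-1-1 : Near (# 1) (just (# 1))
  near-1-1 = just (# 2) , refl , inj₁ refl

  near-2-centre : Near (# 2) nothing
  near-2-centre = just (# 4) , refl , tt

  near-2-3 : Near (# 2) (just (# 3))
  near-2-3 = just (# 4) , refl , inj₁ refl

  far-1-0 : Far (# 1) (just (# 0))
  far-1-0 h' eq with label≡1 h' eq
  ... | inj₁ refl = (λ ()) , λ { (inj₁ ()) ; (inj₂ ()) }
  ... | inj₂ refl = (λ ()) , λ { (inj₁ ()) ; (inj₂ ()) }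

  far-2-1 : Far (# 2) (just (# 1))
  far-2-1 h' eq with label≡2+ h' eq
  ... | refl = (λ ()) , C[5+k]-1≁4 k

  far-2-2 : Far (# 2) (just (# 2))
  far-2-2 h' eq with label≡2+ h' eq
  ... | refl = (λ ()) , C[5+k]-2≁4 k

  label-splits : ∀ {h h'} → h ≢ h' → label h ≡ label h' →
                 ∃[ j ] (j ≢ # 0 × (Splits j h h' ⊎ Splits j h' h))
  label-splits {h} {h'} h≢h' eq with label-collision eq h≢h'
  ... | inj₁ l0 with label≡0 h l0 | label≡0 h' (trans (sym eq) l0)
  ...   | inj₁ refl        | inj₁ refl        = ⊥-elim (h≢h' refl)
  ...   | inj₁ refl        | inj₂ (inj₁ refl) = # 1 , (λ ()) , inj₁ (near-1-centre , far-1-0)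
  ...   | inj₁ refl        | inj₂ (inj₂ refl) = # 2 , (λ ()) , inj₁ (near-2-centre , far-2-1)
  ...   | inj₂ (inj₁ refl) | inj₁ refl        = # 1 , (λ ()) , inj₂ (near-1-centre , far-1-0)
  ...   | inj₂ (inj₁ refl) | inj₂ (inj₁ refl) = ⊥-elim (h≢h' refl)
  ...   | inj₂ (inj₁ refl) | inj₂ (inj₂ refl) = # 1 , (λ ()) , inj₂ (near-1-1 , far-1-0)
  ...   | inj₂ (inj₂ refl) | inj₁ refl        = # 2 , (λ ()) , inj₂ (near-2-centre , far-2-1)
  ...   | inj₂ (inj₂ refl) | inj₂ (inj₁ refl) = # 1 , (λ ()) , inj₁ (near-1-1 , far-1-0)
  ...   | inj₂ (inj₂ refl) | inj₂ (inj₂ refl) = ⊥-elim (h≢h' refl)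
  label-splits {h} {h'} h≢h' eq | inj₂ l1 with label≡1 h l1 | label≡1 h' (trans (sym eq) l1)
  ...   | inj₁ refl | inj₁ refl = ⊥-elim (h≢h' refl)
  ...   | inj₁ refl | inj₂ refl = # 2 , (λ ()) , inj₂ (near-2-3 , far-2-2)
  ...   | inj₂ refl | inj₁ refl = # 2 , (λ ()) , inj₁ (near-2-3 , far-2-2)
  ...   | inj₂ refl | inj₂ refl = ⊥-elim (h≢h' refl)

  G : Graph
  G = K (4 + k) ⊙ W (5 + k)

  open Corona Fin._≟_ Complete.isDistance Wheel.isDistance

  classOf : V G → Fin (4 + k)
  classOf (inj₁ _)       = zero
  classOf (inj₂ (a , h)) = punchIn a (label h)

  class≢copy : ∀ a h → classOf (inj₂ (a , h)) ≢ a
  class≢copy a h = punchInᵢ≢i a (label h)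

  class-in-copy : ∀ {i a} → i ≢ a → ∃[ h ] classOf (inj₂ (a , h)) ≡ i
  class-in-copy {i} {a} i≢a =
    representative j , trans (cong (punchIn a) (label-representative j)) (punchIn-punchOut a≢i)
    where
    a≢i = ≢-sym i≢a
    j   = punchOut a≢i

  copy-class≡0 : ∀ a h → classOf (inj₂ (a , h)) ≡ zero → a ≢ zero
  copy-class≡0 _ _ () refl

  classOf-surjective : ∀ i → ∃[ x ] (∀ {z} → z ≡ x → classOf z ≡ i)
  classOf-surjective zero    = inj₁ zero , λ { refl → refl }
  classOf-surjective (suc j) with class-in-copy {suc j} {zero} (λ ())
  ... | h , eq = inj₂ (zero , h) , λ { refl → eq }

  partition : OrderedPartition G (4 + k)
  partition = record { cls = classOf ; nonempty = classOf-surjective }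

  open ClassDistance isDistance (∈-corona-vertices {K (4 + k)} {W (5 + k)} ∈-allFin ∈-wheel) partition

  hub-near : ∀ {i a} → i ≢ a → ∃[ x ] (classOf x ≡ i × δ (inj₁ a) x ≤ 1)
  hub-near {a = a} i≢a with class-in-copy i≢a
  ... | h , eq = inj₂ (a , h) , eq , ≤-reflexive (δ-hub-own a h)

  hub-near₂ : ∀ {i} a → i ≢ zero → ∃[ x ] (classOf x ≡ i × δ (inj₁ a) x ≤ 2)
  hub-near₂ a i≢0 with class-in-copy i≢0
  ... | h , eq = inj₂ (zero , h) , eq , s≤s (Complete-δ≤1 a zero)

  copy-near : ∀ {i a} h → i ≢ a → ∃[ x ] (classOf x ≡ i × δ (inj₂ (a , h)) x ≤ 2)
  copy-near {a = a} h i≢a with class-in-copy i≢a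
  ... | h' , eq = inj₂ (a , h') , eq , subst (_≤ 2) (sym (δ-copy-own a h h')) (m⊓n≤n _ 2)

  hub-far : ∀ {a} → a ≢ zero → ∀ y → classOf y ≡ a → 1 < δ (inj₁ a) y
  hub-far     a≢0 (inj₁ _)       eq = ⊥-elim (a≢0 (sym eq))
  hub-far {a} a≢0 (inj₂ (b , h)) eq = δ-hub-other {a} {b} h λ { refl → class≢copy b h eq }

  copy-far : ∀ {a} h → a ≢ zero → ∀ y → classOf y ≡ a → 2 < δ (inj₂ (a , h)) y
  copy-far     h a≢0 (inj₁ _)        eq = ⊥-elim (a≢0 (sym eq))
  copy-far {a} h a≢0 (inj₂ (b , h')) eq = δ-copy-other {a} {b} h h' λ { refl → class≢copy b h' eq }

  separates-hubs : ∀ {a c} → a ≢ c → a ≢ zero → Separates (inj₁ c) (inj₁ a) a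
  separates-hubs a≢c a≢0 = 1 , hub-near a≢c , hub-far a≢0

  separates-hub-copy : ∀ {c} a h → c ≢ zero → Separates (inj₁ a) (inj₂ (c , h)) c
  separates-hub-copy a h c≢0 = 2 , hub-near₂ a c≢0 , copy-far h c≢0

  separates-copies : ∀ {a c} h h' → a ≢ c → a ≢ zero → Separates (inj₂ (c , h')) (inj₂ (a , h)) a
  separates-copies h h' a≢c a≢0 = 2 , copy-near h' a≢c , copy-far h a≢0

  -- The separating class is not the hubs' class 0, so inside copy a the distances to it are
  -- those of the wheel, and every other copy is at distance 3.
  separates-in-copy : ∀ {a h h' j} → j ≢ # 0 → Splits j h h' →
                      Separates (inj₂ (a , h)) (inj₂ (a , h')) (punchIn a j)
  separates-in-copy {a} {h} {h'} {j} j≢0 ((n , ln , h~n) , far) = 1 , near , beyond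
    where
    near : ∃[ x ] (classOf x ≡ punchIn a j × δ (inj₂ (a , h)) x ≤ 1)
    near = inj₂ (a , n) , cong (punchIn a) ln ,
           subst (_≤ 1) (sym (δ-copy-own a h n))
                 (≤-trans (m⊓n≤m _ 2) (IsDistance.adj⇒δ≤1 Wheel.isDistance h~n))

    beyond : ∀ y → classOf y ≡ punchIn a j → 1 < δ (inj₂ (a , h')) y
    beyond (inj₁ _)       eq = ⊥-elim (j≢0 (punchIn≡zero⇒≡zero a j (sym eq)))
    beyond (inj₂ (b , f)) eq = by-cases (a Fin.≟ b)
      where
      by-cases : Dec (a ≡ b) → 1 < δ (inj₂ (a , h')) (inj₂ (b , f))
      by-cases (no a≢b)   = <-trans (s≤s (s≤s z≤n)) (δ-copy-other h' f a≢b)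
      by-cases (yes refl) with far f (punchIn-injective a (label f) j eq)
      ... | h'≢f , ¬h'~f =
        subst (1 <_) (sym (δ-copy-own a h' f))
              (⊓-glb (≤-reflexive (sym (Wheel.non-adjacent⇒δ≡2 h'≢f ¬h'~f))) ≤-refl)

  distinguished-in-copy : ∀ a {h h'} → h ≢ h' → classOf (inj₂ (a , h)) ≡ classOf (inj₂ (a , h')) →
                          Distinguished (inj₂ (a , h)) (inj₂ (a , h'))
  distinguished-in-copy a h≢h' eq with label-splits h≢h' (punchIn-injective a _ _ eq)
  ... | j , j≢0 , inj₁ s = punchIn a j , inj₁ (separates-in-copy j≢0 s)
  ... | j , j≢0 , inj₂ s = punchIn a j , inj₂ (separates-in-copy j≢0 s)

  distinguished-same-class : ∀ u v → u ≢ v → classOf u ≡ classOf v → Distinguished u v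
  distinguished-same-class (inj₁ a) (inj₁ c) u≢v _ with a Fin.≟ zero
  ... | no a≢0   = a , inj₂ (separates-hubs (λ { refl → u≢v refl }) a≢0)
  ... | yes refl = c , inj₁ (separates-hubs (λ { refl → u≢v refl }) (λ { refl → u≢v refl }))
  distinguished-same-class (inj₁ a) (inj₂ (c , h)) _ cu≡cv =
    c , inj₁ (separates-hub-copy a h (copy-class≡0 c h (sym cu≡cv)))
  distinguished-same-class (inj₂ (c , h)) (inj₁ a) _ cu≡cv =
    c , inj₂ (separates-hub-copy a h (copy-class≡0 c h cu≡cv))
  distinguished-same-class (inj₂ (a , h)) (inj₂ (c , h')) u≢v cu≡cv with a Fin.≟ c
  ... | yes refl = distinguished-in-copy a (λ { refl → u≢v refl }) cu≡cv
  ... | no a≢c with a Fin.≟ zero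
  ...   | no a≢0   = a , inj₂ (separates-copies h h' a≢c a≢0)
  ...   | yes refl = c , inj₁ (separates-copies h' h (≢-sym a≢c) (≢-sym a≢c))

  distinguished : ∀ {u v} → u ≢ v → Distinguished u v
  distinguished {u} {v} u≢v with classOf u Fin.≟ classOf v
  ... | no cu≢cv  = classOf u , inj₁ (separates-own-class {u} {v} cu≢cv)
  ... | yes cu≡cv = distinguished-same-class u v u≢v cu≡cv

  partition-resolving : Resolving G partition
  partition-resolving = resolving distinguished

lemma3p5 : (n : ℕ) → 4 ≤ n → pd≤ (K n ⊙ W (suc n)) n
lemma3p5 (suc (suc (suc (suc k)))) (s≤s (s≤s (s≤s (s≤s z≤n)))) =
  4 + k , ≤-refl , partition , partition-resolving
  where open Construction k
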